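{- Let $(g(x),f(x))$ be a Riordan array. Then the $A$-sequence of the vertical half of $(g(x),f(x))$ has generating function $\frac{f(x)}{x}$.
   Context: All power series are formal power series with complex coefficients. A Riordan array is a pair $(g(x),f(x))$ of power series with $g(0)\neq 0$, $f(0)=0$, $f'(0)\neq 0$; it is identified with the infinite lower triangular matrix $(t_{n,k})_{n,k\ge 0}$, $t_{n,k}=[x^n]g(x)f(x)^k$. The vertical half of a Riordan array with matrix $(t_{n,k})$ is the matrix whose $(n,k)$ entry is $t_{2n-k,n}$ (with $t_{i,j}=0$ for $j>i$); it is again a Riordan array. The $A$-sequence of a Riordan array $(u(x),v(x))$ is the sequence whose generating function $A(x)$ is the unique power series with $v(x)=x\,A(v(x))$. -}

module Defs where

open import Level using (Level; _⊔_)
open import Data.Nat using (ℕ; zero; suc; _∸_; _≤?_) renaming (_*_ to _*ℕ_)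
open import Data.Product using (Σ; _×_; ∃)
open import Relation.Nullary using (¬_; yes; no)
open import Algebra.Bundles using (CommutativeRing)

IsField : ∀ {c ℓ} → CommutativeRing c ℓ → Set (c ⊔ ℓ)
IsField R = (¬ (1# ≈ 0#)) × (∀ x → ¬ (x ≈ 0#) → ∃ λ y → x * y ≈ 1#)
  where open CommutativeRing R

module PowerSeries {c ℓ} (R : CommutativeRing c ℓ) where
  open CommutativeRing R using (Carrier; _≈_; _+_; _*_; 0#; 1#)

  Series : Set c
  Series = ℕ → Carrier

  sumUpTo : (ℕ → Carrier) → ℕ → Carrier
  sumUpTo h zero    = h zero
  sumUpTo h (suc n) = sumUpTo h n + h (suc n)

  _·_ : Series → Series → Series
  (a · b) n = sumUpTo (λ i → a i * b (n ∸ i)) n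

  oneS : Series
  oneS zero    = 1#
  oneS (suc _) = 0#

  _^_ : Series → ℕ → Series
  a ^ zero  = oneS
  a ^ suc k = a · (a ^ k)

  xmul : Series → Series
  xmul b zero    = 0#
  xmul b (suc n) = b n

  divx : Series → Series
  divx f n = f (suc n)

  -- composition A(v(x)), for v(0) = 0 : [x^n] A(v) = Σ_{k=0}^{n} A_k [x^n] v^k
  _∘ₛ_ : Series → Series → Series
  (A ∘ₛ v) n = sumUpTo (λ k → A k * (v ^ k) n) n

  IsRiordan : Series → Series → Set ℓ
  IsRiordan g f = (¬ (g 0 ≈ 0#)) × (f 0 ≈ 0#) × (¬ (f 1 ≈ 0#))

  riordanEntry : Series → Series → ℕ → ℕ → Carrier
  riordanEntry g f n k = (g · (f ^ k)) n

  verticalHalf : Series → Series → ℕ → ℕ → Carrier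
  verticalHalf g f n k with k ≤? 2 *ℕ n
  ... | yes _ = riordanEntry g f (2 *ℕ n ∸ k) n
  ... | no  _ = 0#

  IsASequence : Series → Series → Series → Set ℓ
  IsASequence u v A = ∀ n → v n ≈ xmul (A ∘ₛ v) n

-- Write f = x φ with φ = f/x. Then t_{2n-k,n} = [x^{2n-k}] g f^n = [x^n] x^k g φ^n, so the
-- vertical half is determined by the series g φ^n. Let v solve v = x φ(v) and put
-- u_n = [x^n] g φ^n. Induction on n shows [x^n] u v^k = [x^n] x^k g φ^n: the equation
-- v = x φ(v) turns [x^{n+1}] u v^{k+1} into Σ_j φ_j [x^n] u v^{j+k}, and on the other side
-- Σ_j φ_j [x^n] x^{j+k} g φ^n = [x^n] x^k g φ^{n+1}. Hence (u, v) is the vertical half, and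
-- v = x φ(v) says that its A-sequence is φ = f/x.
module Submission where

open import Defs
open import Algebra.Bundles using (CommutativeRing)
open import Data.Nat using (ℕ; zero; suc; _∸_; _≤_; _<_; _≤′_; ≤′-refl; ≤′-step; z≤n; s≤s; _≤?_)
  renaming (_+_ to _+ℕ_; _*_ to _*ℕ_)
import Data.Nat.Properties as ℕₚ
open import Data.Product using (Σ; _×_; _,_; proj₁; proj₂)
open import Relation.Nullary using (yes; no)
open import Relation.Binary.PropositionalEquality as ≡ using (_≡_)

module Sums {c ℓ} (R : CommutativeRing c ℓ) where
  open CommutativeRing R
  open PowerSeries R using (sumUpTo)
  open import Algebra.Properties.CommutativeSemigroup +-commutativeSemigroup using (interchange)
  open import Relation.Binary.Reasoning.Setoid setoid

  sumUpTo-cong : ∀ {h h′} n → (∀ i → i ≤ n → h i ≈ h′ i) → sumUpTo h n ≈ sumUpTo h′ n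
  sumUpTo-cong zero    h≈h′ = h≈h′ 0 z≤n
  sumUpTo-cong (suc n) h≈h′ =
    +-cong (sumUpTo-cong n (λ i i≤n → h≈h′ i (ℕₚ.m≤n⇒m≤1+n i≤n))) (h≈h′ (suc n) ℕₚ.≤-refl)

  sumUpTo-zero : ∀ h n → (∀ i → i ≤ n → h i ≈ 0#) → sumUpTo h n ≈ 0#
  sumUpTo-zero h n h≈0 = trans (sumUpTo-cong n h≈0) (zero-sum n)
    where
    zero-sum : ∀ n → sumUpTo (λ _ → 0#) n ≈ 0#
    zero-sum zero    = refl
    zero-sum (suc n) = trans (+-cong (zero-sum n) refl) (+-identityˡ 0#)

  sumUpTo-distrib-+ : ∀ h h′ n → sumUpTo (λ i → h i + h′ i) n ≈ sumUpTo h n + sumUpTo h′ n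
  sumUpTo-distrib-+ h h′ zero    = refl
  sumUpTo-distrib-+ h h′ (suc n) = trans (+-cong (sumUpTo-distrib-+ h h′ n) refl) (interchange _ _ _ _)

  *-distribˡ-sumUpTo : ∀ x h n → x * sumUpTo h n ≈ sumUpTo (λ i → x * h i) n
  *-distribˡ-sumUpTo x h zero    = refl
  *-distribˡ-sumUpTo x h (suc n) = trans (distribˡ x _ _) (+-cong (*-distribˡ-sumUpTo x h n) refl)

  *-distribʳ-sumUpTo : ∀ x h n → sumUpTo h n * x ≈ sumUpTo (λ i → h i * x) n
  *-distribʳ-sumUpTo x h zero    = refl
  *-distribʳ-sumUpTo x h (suc n) = trans (distribʳ x _ _) (+-cong (*-distribʳ-sumUpTo x h n) refl)

  sumUpTo-suc-head : ∀ h n → sumUpTo h (suc n) ≈ h 0 + sumUpTo (λ i → h (suc i)) n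
  sumUpTo-suc-head h zero    = refl
  sumUpTo-suc-head h (suc n) = trans (+-cong (sumUpTo-suc-head h n) refl) (+-assoc _ _ _)

  sumUpTo-reverse : ∀ h n → sumUpTo h n ≈ sumUpTo (λ i → h (n ∸ i)) n
  sumUpTo-reverse h zero    = refl
  sumUpTo-reverse h (suc n) = trans (+-cong (sumUpTo-reverse h n) refl)
    (trans (+-comm _ _) (sym (sumUpTo-suc-head (λ i → h (suc n ∸ i)) n)))

  sumUpTo-extend : ∀ h {m n} → m ≤ n → (∀ i → m < i → i ≤ n → h i ≈ 0#) →
                   sumUpTo h n ≈ sumUpTo h m
  sumUpTo-extend h m≤n = extend (ℕₚ.≤⇒≤′ m≤n)
    where
    extend : ∀ {m n} → m ≤′ n → (∀ i → m < i → i ≤ n → h i ≈ 0#) → sumUpTo h n ≈ sumUpTo h m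
    extend ≤′-refl         _   = refl
    extend (≤′-step m≤′n) h≈0 =
      trans (+-cong (extend m≤′n (λ i m<i i≤n → h≈0 i m<i (ℕₚ.m≤n⇒m≤1+n i≤n)))
                    (h≈0 _ (s≤s (ℕₚ.≤′⇒≤ m≤′n)) ℕₚ.≤-refl))
            (+-identityʳ _)

  sumUpTo-comm : ∀ (H : ℕ → ℕ → Carrier) n m →
    sumUpTo (λ i → sumUpTo (H i) m) n ≈ sumUpTo (λ j → sumUpTo (λ i → H i j) n) m
  sumUpTo-comm H zero    m = refl
  sumUpTo-comm H (suc n) m = trans (+-cong (sumUpTo-comm H n m) refl) (sym (sumUpTo-distrib-+ _ _ m))

  sumUpTo-triangle : ∀ (H : ℕ → ℕ → Carrier) n →
    sumUpTo (λ i → sumUpTo (H i) i) n ≈ sumUpTo (λ j → sumUpTo (λ l → H (j +ℕ l) j) (n ∸ j)) n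
  sumUpTo-triangle H zero    = refl
  sumUpTo-triangle H (suc n) = begin
    sumUpTo (λ i → sumUpTo (H i) i) n + sumUpTo (H (suc n)) (suc n)
      ≈⟨ +-cong (sumUpTo-triangle H n) refl ⟩
    columns n + (sumUpTo (H (suc n)) n + H (suc n) (suc n))
      ≈⟨ +-assoc _ _ _ ⟨
    (columns n + sumUpTo (H (suc n)) n) + H (suc n) (suc n)
      ≈⟨ +-cong (sumUpTo-distrib-+ _ _ n) refl ⟨
    sumUpTo (λ j → column n j + H (suc n) j) n + H (suc n) (suc n)
      ≈⟨ +-cong (sumUpTo-cong n (λ j j≤n → sym (column-suc j j≤n))) last-column ⟩
    columns (suc n) ∎
    where
    column : ℕ → ℕ → Carrier
    column m j = sumUpTo (λ l → H (j +ℕ l) j) (m ∸ j)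
    columns : ℕ → Carrier
    columns m = sumUpTo (column m) m
    column-suc : ∀ j → j ≤ n → column (suc n) j ≈ column n j + H (suc n) j
    column-suc j j≤n
      rewrite ℕₚ.+-∸-assoc 1 j≤n | ℕₚ.+-suc j (n ∸ j) | ℕₚ.m+[n∸m]≡n j≤n = refl
    last-column : H (suc n) (suc n) ≈ column (suc n) (suc n)
    last-column rewrite ℕₚ.n∸n≡0 n | ℕₚ.+-identityʳ n = refl

module SeriesAlgebra {c ℓ} (R : CommutativeRing c ℓ) where
  open CommutativeRing R
  open PowerSeries R
  open Sums R
  open import Relation.Binary.Reasoning.Setoid setoid

  infix 4 _≋_
  _≋_ : Series → Series → Set ℓ
  a ≋ b = ∀ i → a i ≈ b i

  ·-cong-upTo : ∀ {a a′ b b′} n → (∀ i → i ≤ n → a i ≈ a′ i) → (∀ i → i ≤ n → b i ≈ b′ i) →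
                (a · b) n ≈ (a′ · b′) n
  ·-cong-upTo n a≈a′ b≈b′ =
    sumUpTo-cong n (λ i i≤n → *-cong (a≈a′ i i≤n) (b≈b′ (n ∸ i) (ℕₚ.m∸n≤m n i)))

  ·-cong : ∀ {a a′ b b′} → a ≋ a′ → b ≋ b′ → a · b ≋ a′ · b′
  ·-cong a≋a′ b≋b′ n = ·-cong-upTo n (λ i _ → a≋a′ i) (λ i _ → b≋b′ i)

  ·-congˡ : ∀ a {b b′} → b ≋ b′ → a · b ≋ a · b′
  ·-congˡ a = ·-cong (λ _ → refl)

  ·-congʳ : ∀ b {a a′} → a ≋ a′ → a · b ≋ a′ · b
  ·-congʳ b a≋a′ = ·-cong {b = b} a≋a′ (λ _ → refl)

  ·-comm : ∀ a b → a · b ≋ b · a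
  ·-comm a b n = trans (sumUpTo-reverse _ n) (sumUpTo-cong n (λ i i≤n →
    trans (*-comm _ _) (*-cong (reflexive (≡.cong b (ℕₚ.m∸[m∸n]≡n i≤n))) refl)))

  ·-assoc : ∀ a b d → (a · b) · d ≋ a · (b · d)
  ·-assoc a b d n = begin
    sumUpTo (λ i → sumUpTo (λ j → a j * b (i ∸ j)) i * d (n ∸ i)) n
      ≈⟨ sumUpTo-cong n (λ i _ → *-distribʳ-sumUpTo _ _ i) ⟩
    sumUpTo (λ i → sumUpTo (λ j → (a j * b (i ∸ j)) * d (n ∸ i)) i) n
      ≈⟨ sumUpTo-triangle (λ i j → (a j * b (i ∸ j)) * d (n ∸ i)) n ⟩
    sumUpTo (λ j → sumUpTo (λ l → (a j * b (j +ℕ l ∸ j)) * d (n ∸ (j +ℕ l))) (n ∸ j)) n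
      ≈⟨ sumUpTo-cong n (λ j _ → sumUpTo-cong (n ∸ j) (λ l _ → trans (*-assoc _ _ _)
           (*-cong refl (*-cong (reflexive (≡.cong b (ℕₚ.m+n∸m≡n j l)))
                                (reflexive (≡.cong d (≡.sym (ℕₚ.∸-+-assoc n j l)))))))) ⟩
    sumUpTo (λ j → sumUpTo (λ l → a j * (b l * d (n ∸ j ∸ l))) (n ∸ j)) n
      ≈⟨ sumUpTo-cong n (λ j _ → *-distribˡ-sumUpTo _ _ (n ∸ j)) ⟨
    sumUpTo (λ j → a j * (b · d) (n ∸ j)) n ∎

  ·-leftComm : ∀ a b d → a · (b · d) ≋ b · (a · d)
  ·-leftComm a b d n = begin
    (a · (b · d)) n ≈⟨ ·-comm a _ n ⟩
    ((b · d) · a) n ≈⟨ ·-assoc b d a n ⟩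
    (b · (d · a)) n ≈⟨ ·-congˡ b (·-comm d a) n ⟩
    (b · (a · d)) n ∎

  ·-identityʳ : ∀ a → a · oneS ≋ a
  ·-identityʳ a zero    = *-identityʳ _
  ·-identityʳ a (suc n) = begin
    sumUpTo (λ i → a i * oneS (suc n ∸ i)) n + a (suc n) * oneS (suc n ∸ suc n)
      ≈⟨ +-cong (sumUpTo-zero _ n (λ i i≤n → trans (*-cong refl (reflexive
                   (≡.cong oneS (ℕₚ.+-∸-assoc 1 i≤n)))) (zeroʳ _)))
                (*-cong refl (reflexive (≡.cong oneS (ℕₚ.n∸n≡0 n)))) ⟩
    0# + a (suc n) * 1#
      ≈⟨ trans (+-identityˡ _) (*-identityʳ _) ⟩
    a (suc n) ∎

  ·-identityˡ : ∀ a → oneS · a ≋ a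
  ·-identityˡ a n = trans (·-comm oneS a n) (·-identityʳ a n)

  xmul-cong : ∀ {a b} → a ≋ b → xmul a ≋ xmul b
  xmul-cong a≋b zero    = refl
  xmul-cong a≋b (suc i) = a≋b i

  xmul-·ˡ : ∀ a b → xmul a · b ≋ xmul (a · b)
  xmul-·ˡ a b zero    = zeroˡ _
  xmul-·ˡ a b (suc n) = trans (sumUpTo-suc-head _ n) (trans (+-cong (zeroˡ _) refl) (+-identityˡ _))

  xmul-divx : ∀ a → a 0 ≈ 0# → a ≋ xmul (divx a)
  xmul-divx a a₀≈0 zero    = a₀≈0
  xmul-divx a a₀≈0 (suc i) = refl

  shift : ℕ → Series → Series
  shift zero    b = b
  shift (suc n) b = xmul (shift n b)

  shift-cong : ∀ n {a b} → a ≋ b → shift n a ≋ shift n b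
  shift-cong zero    a≋b = a≋b
  shift-cong (suc n) a≋b = xmul-cong (shift-cong n a≋b)

  shift-+ : ∀ n b m → shift n b (n +ℕ m) ≡ b m
  shift-+ zero    b m = ≡.refl
  shift-+ (suc n) b m = shift-+ n b m

  shift-< : ∀ n b {i} → i < n → shift n b i ≡ 0#
  shift-< (suc n) b {zero}  _         = ≡.refl
  shift-< (suc n) b {suc i} (s≤s i<n) = shift-< n b i<n

  shift-shift : ∀ j k b → shift (j +ℕ k) b ≡ shift j (shift k b)
  shift-shift zero    k b = ≡.refl
  shift-shift (suc j) k b = ≡.cong xmul (shift-shift j k b)

  shift-·ʳ : ∀ n a b → a · shift n b ≋ shift n (a · b)
  shift-·ʳ zero    a b i = refl
  shift-·ʳ (suc n) a b i = begin
    (a · xmul (shift n b)) i  ≈⟨ ·-comm a _ i ⟩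
    (xmul (shift n b) · a) i  ≈⟨ xmul-·ˡ _ a i ⟩
    xmul (shift n b · a) i    ≈⟨ xmul-cong (λ j → trans (·-comm _ a j) (shift-·ʳ n a b j)) i ⟩
    shift (suc n) (a · b) i   ∎

  ·-sum-shifts : ∀ a b n → (a · b) n ≈ sumUpTo (λ j → a j * shift j b n) n
  ·-sum-shifts a b n = sumUpTo-cong n (λ j j≤n → *-cong refl (reflexive (≡.sym
    (≡.subst (λ m → shift j b m ≡ b (n ∸ j)) (ℕₚ.m+[n∸m]≡n j≤n) (shift-+ j b (n ∸ j))))))

  ^-+ : ∀ a j k → (a ^ j) · (a ^ k) ≋ a ^ (j +ℕ k)
  ^-+ a zero    k   = ·-identityˡ _
  ^-+ a (suc j) k n = trans (·-assoc a (a ^ j) (a ^ k) n) (·-congˡ a (^-+ a j k) n)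

  ^-xmul : ∀ {a b} → a ≋ xmul b → ∀ n → a ^ n ≋ shift n (b ^ n)
  ^-xmul a≋xb zero    i = refl
  ^-xmul {a} {b} a≋xb (suc n) i = begin
    (a · (a ^ n)) i                   ≈⟨ ·-cong a≋xb (^-xmul a≋xb n) i ⟩
    (xmul b · shift n (b ^ n)) i      ≈⟨ xmul-·ˡ b (shift n (b ^ n)) i ⟩
    xmul (b · shift n (b ^ n)) i      ≈⟨ xmul-cong (shift-·ʳ n b (b ^ n)) i ⟩
    shift (suc n) (b · (b ^ n)) i     ∎

  ^-vanishes-below : ∀ a → a 0 ≈ 0# → ∀ {i j} → i < j → (a ^ j) i ≈ 0#
  ^-vanishes-below a a₀≈0 {i} {j} i<j =
    trans (^-xmul (xmul-divx a a₀≈0) j i) (reflexive (shift-< j (divx a ^ j) i<j))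

  ^-cong-upTo : ∀ {a a′} k n → (∀ i → i ≤ n → a i ≈ a′ i) → ∀ i → i ≤ n → (a ^ k) i ≈ (a′ ^ k) i
  ^-cong-upTo zero    n a≈a′ i i≤n = refl
  ^-cong-upTo (suc k) n a≈a′ i i≤n = ·-cong-upTo i
    (λ j j≤i → a≈a′ j (ℕₚ.≤-trans j≤i i≤n))
    (λ j j≤i → ^-cong-upTo k n a≈a′ j (ℕₚ.≤-trans j≤i i≤n))

  ∘ₛ-cong-upTo : ∀ A {a a′} n → (∀ i → i ≤ n → a i ≈ a′ i) → (A ∘ₛ a) n ≈ (A ∘ₛ a′) n
  ∘ₛ-cong-upTo A n a≈a′ = sumUpTo-cong n (λ k _ → *-cong refl (^-cong-upTo k n a≈a′ n ℕₚ.≤-refl))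

  ∘ₛ-· : ∀ A v w → v 0 ≈ 0# → ∀ n → ((A ∘ₛ v) · w) n ≈ sumUpTo (λ j → A j * ((v ^ j) · w) n) n
  ∘ₛ-· A v w v₀≈0 n = begin
    sumUpTo (λ i → sumUpTo (λ j → A j * (v ^ j) i) i * w (n ∸ i)) n
      ≈⟨ sumUpTo-cong n (λ i _ → *-distribʳ-sumUpTo _ _ i) ⟩
    sumUpTo (λ i → sumUpTo (term i) i) n
      ≈⟨ sumUpTo-cong n (λ i i≤n → sumUpTo-extend (term i) i≤n (λ j i<j _ → term-vanishes i<j)) ⟨
    sumUpTo (λ i → sumUpTo (term i) n) n
      ≈⟨ sumUpTo-comm term n n ⟩
    sumUpTo (λ j → sumUpTo (λ i → term i j) n) n
      ≈⟨ sumUpTo-cong n (λ j _ → trans (sumUpTo-cong n (λ i _ → *-assoc _ _ _))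
                                       (sym (*-distribˡ-sumUpTo _ _ n))) ⟩
    sumUpTo (λ j → A j * ((v ^ j) · w) n) n ∎
    where
    term : ℕ → ℕ → Carrier
    term i j = (A j * (v ^ j) i) * w (n ∸ i)
    term-vanishes : ∀ {i j} → i < j → term i j ≈ 0#
    term-vanishes i<j =
      trans (*-cong (trans (*-cong refl (^-vanishes-below v v₀≈0 i<j)) (zeroʳ _)) refl) (zeroˡ _)

  shift-transpose : ∀ n k b {i j} → i +ℕ k ≡ j +ℕ n → shift n b i ≡ shift k b j
  shift-transpose zero k b {i} {j} i+k≡j+0 = ≡.sym (≡.trans (≡.cong (shift k b) j≡k+i) (shift-+ k b i))
    where
    j≡k+i : j ≡ k +ℕ i
    j≡k+i = ≡.trans (≡.sym (ℕₚ.+-identityʳ j)) (≡.trans (≡.sym i+k≡j+0) (ℕₚ.+-comm i k))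
  shift-transpose (suc n) zero b {i} {j} i+0≡j+n = ≡.trans (≡.cong (shift (suc n) b) i≡n+j) (shift-+ (suc n) b j)
    where
    i≡n+j : i ≡ suc n +ℕ j
    i≡n+j = ≡.trans (≡.sym (ℕₚ.+-identityʳ i)) (≡.trans i+0≡j+n (ℕₚ.+-comm j (suc n)))
  shift-transpose (suc n) (suc k) b {zero}  {zero}  _  = ≡.refl
  shift-transpose (suc n) (suc k) b {zero}  {suc j} eq =
    ≡.sym (shift-< k b (≡.subst (j <_) (ℕₚ.suc-injective (≡.sym eq)) (ℕₚ.m<m+n j ℕₚ.0<1+n)))
  shift-transpose (suc n) (suc k) b {suc i} {zero}  eq =
    shift-< n b (≡.subst (i <_) (ℕₚ.suc-injective eq) (ℕₚ.m<m+n i ℕₚ.0<1+n))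
  shift-transpose (suc n) (suc k) b {suc i} {suc j} eq = shift-transpose n k b
    (ℕₚ.suc-injective (≡.trans (≡.sym (ℕₚ.+-suc i k))
                      (≡.trans (ℕₚ.suc-injective eq) (ℕₚ.+-suc j n))))

module Fixpoint {c ℓ} (R : CommutativeRing c ℓ) (φ : PowerSeries.Series R) where
  open CommutativeRing R
  open PowerSeries R
  open SeriesAlgebra R

  approx : ℕ → Series
  approx zero    _ = 0#
  approx (suc m)   = xmul (φ ∘ₛ approx m)

  approx-stable : ∀ {m m′} → m ≤ m′ → ∀ i → i ≤ m → approx m i ≈ approx m′ i
  approx-stable {m′ = zero}  z≤n        zero    _         = refl
  approx-stable {m′ = suc _} z≤n        zero    _         = refl
  approx-stable              (s≤s _)    zero    _         = refl
  approx-stable              (s≤s m≤m′) (suc i) (s≤s i≤m) =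
    ∘ₛ-cong-upTo φ i (λ j j≤i → approx-stable m≤m′ j (ℕₚ.≤-trans j≤i i≤m))

  fixpoint : Series
  fixpoint n = approx n n

  fixpoint-eq : fixpoint ≋ xmul (φ ∘ₛ fixpoint)
  fixpoint-eq zero    = refl
  fixpoint-eq (suc n) = ∘ₛ-cong-upTo φ n (λ i i≤n → sym (approx-stable i≤n i ℕₚ.≤-refl))

module VerticalHalf {c ℓ} (R : CommutativeRing c ℓ) (g f : PowerSeries.Series R) where
  open CommutativeRing R
  open PowerSeries R
  open Sums R
  open SeriesAlgebra R
  open import Relation.Binary.Reasoning.Setoid setoid

  φ : Series
  φ = divx f

  open Fixpoint R φ using (fixpoint; fixpoint-eq)

  gφ^ : ℕ → Series
  gφ^ n = g · (φ ^ n)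

  u v : Series
  u n = gφ^ n n
  v   = fixpoint

  isRiordan : IsRiordan g f → IsRiordan u v
  isRiordan (g₀≉0 , _ , f₁≉0) =
    (λ u₀≈0 → g₀≉0 (trans (sym (*-identityʳ _)) u₀≈0)) ,
    refl ,
    (λ v₁≈0 → f₁≉0 (trans (sym (*-identityʳ _)) v₁≈0))

  verticalHalf-shift : f 0 ≈ 0# → ∀ n k → verticalHalf g f n k ≈ shift k (gφ^ n) n
  verticalHalf-shift f₀≈0 n k with k ≤? 2 *ℕ n
  ... | no k≰2n = sym (reflexive (shift-< k _ (ℕₚ.≤-<-trans (ℕₚ.m≤m+n n _) (ℕₚ.≰⇒> k≰2n))))
  ... | yes k≤2n = begin
    (g · (f ^ n)) (2 *ℕ n ∸ k)          ≈⟨ ·-congˡ g (^-xmul (xmul-divx f f₀≈0) n) (2 *ℕ n ∸ k) ⟩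
    (g · shift n (φ ^ n)) (2 *ℕ n ∸ k)  ≈⟨ shift-·ʳ n g (φ ^ n) (2 *ℕ n ∸ k) ⟩
    shift n (gφ^ n) (2 *ℕ n ∸ k)        ≡⟨ shift-transpose n k (gφ^ n) indices ⟩
    shift k (gφ^ n) n                   ∎
    where
    indices : 2 *ℕ n ∸ k +ℕ k ≡ n +ℕ n
    indices = ≡.trans (ℕₚ.m∸n+n≡m k≤2n) (≡.cong (n +ℕ_) (ℕₚ.+-identityʳ n))

  riordanEntry-shift : ∀ n k → riordanEntry u v n k ≈ shift k (gφ^ n) n
  riordanEntry-shift n       zero    = ·-identityʳ u n
  riordanEntry-shift zero    (suc k) = trans (*-cong refl (zeroˡ _)) (zeroʳ _)
  riordanEntry-shift (suc n) (suc k) = begin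
    (u · (v · (v ^ k))) (suc n)                          ≈⟨ ·-leftComm u v (v ^ k) (suc n) ⟩
    (v · (u · (v ^ k))) (suc n)                          ≈⟨ ·-congʳ (u · (v ^ k)) fixpoint-eq (suc n) ⟩
    (xmul (φ ∘ₛ v) · (u · (v ^ k))) (suc n)              ≈⟨ xmul-·ˡ (φ ∘ₛ v) (u · (v ^ k)) (suc n) ⟩
    ((φ ∘ₛ v) · (u · (v ^ k))) n                         ≈⟨ ∘ₛ-· φ v (u · (v ^ k)) refl n ⟩
    sumUpTo (λ j → φ j * ((v ^ j) · (u · (v ^ k))) n) n  ≈⟨ sumUpTo-cong n (λ j _ → *-cong refl (lower j)) ⟩
    sumUpTo (λ j → φ j * shift j (shift k (gφ^ n)) n) n  ≈⟨ ·-sum-shifts φ (shift k (gφ^ n)) n ⟨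
    (φ · shift k (gφ^ n)) n                              ≈⟨ shift-·ʳ k φ (gφ^ n) n ⟩
    shift k (φ · gφ^ n) n                                ≈⟨ shift-cong k (·-leftComm φ g (φ ^ n)) n ⟩
    shift k (gφ^ (suc n)) n                              ∎
    where
    lower : ∀ j → ((v ^ j) · (u · (v ^ k))) n ≈ shift j (shift k (gφ^ n)) n
    lower j = begin
      ((v ^ j) · (u · (v ^ k))) n  ≈⟨ ·-leftComm (v ^ j) u (v ^ k) n ⟩
      (u · ((v ^ j) · (v ^ k))) n  ≈⟨ ·-congˡ u (^-+ v j k) n ⟩
      riordanEntry u v n (j +ℕ k)  ≈⟨ riordanEntry-shift n (j +ℕ k) ⟩
      shift (j +ℕ k) (gφ^ n) n     ≡⟨ ≡.cong (λ s → s n) (shift-shift j k (gφ^ n)) ⟩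
      shift j (shift k (gφ^ n)) n  ∎

mainTheorem7 : ∀ {c ℓ} (R : CommutativeRing c ℓ) → IsField R →
    let open CommutativeRing R using (_≈_)
        open PowerSeries R
    in (g f : Series) → IsRiordan g f →
       Σ (Series × Series) λ uv →
         let u = proj₁ uv
             v = proj₂ uv
         in IsRiordan u v
            × (∀ n k → riordanEntry u v n k ≈ verticalHalf g f n k)
            × IsASequence u v (divx f)
mainTheorem7 R _ g f g,f-riordan@(_ , f₀≈0 , _) =
  (u , v) ,
  isRiordan g,f-riordan ,
  (λ n k → trans (riordanEntry-shift n k) (sym (verticalHalf-shift f₀≈0 n k))) ,
  fixpoint-eq
  where
  open CommutativeRing R using (trans; sym)
  open VerticalHalf R g f
  open Fixpoint R φ using (fixpoint-eq)
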